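{- Let $G$ and $H$ be connected bipartite graphs of diameter at most $3$ with $G\approx H$. Then $|\mathrm{Hom}(G,T)| = |\mathrm{Hom}(H,T)|$ for every finite tree $T$.
   Context: All graphs are finite, simple and undirected. $\mathrm{Hom}(G,H)$ is the set of homomorphisms from $G$ to $H$. A tree is a connected acyclic graph; the diameter of a connected graph is the least $p$ such that any two distinct vertices are joined by a path of length at most $p$. For a vertex set $S$, $N(S)$ is the set of vertices adjacent to some vertex of $S$. Two connected bipartite graphs $G,H$ (with at least two vertices) are neighbourhood size equivalent, $G\approx H$, if there are bipartitions $(X^G,Y^G)$ of $G$ and $(X^H,Y^H)$ of $H$ with $|X^G|\le|Y^G|$, $|X^H|\le|Y^H|$, $|X^G|=|X^H|$, $|Y^G|=|Y^H|$, and a bijection $\eta$ from the power set of $X^G$ to the power set of $X^H$ such that for every $S\subseteq X^G$: $|\eta(S)|=|S|$ and $|N(\eta(S))| = |N(S)|$. -}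

module Defs where

open import Data.Nat using (ℕ; zero; suc; _≤_)
open import Data.Bool using (Bool; true; false; not; _∧_; _∨_)
open import Data.Fin using (Fin; inject₁) renaming (suc to fsuc)
open import Data.Fin.Properties using (all?)
open import Data.Fin.Subset using (Subset; _⊆_; ∣_∣)
open import Data.Vec using (Vec; []; _∷_; lookup; head; last; tabulate)
open import Data.List using (List; [_]; concatMap; map; allFin; filter; length)
open import Data.Product using (Σ; ∃; ∃-syntax; _×_)
open import Relation.Binary.PropositionalEquality using (_≡_; _≢_)
open import Relation.Nullary using (Dec; ¬_)
open import Relation.Nullary.Decidable using (_→-dec_)
open import Data.Bool.Properties using () renaming (_≟_ to _≟B_)

record Graph (n : ℕ) : Set where
  field
    adj    : Fin n → Fin n → Bool
    sym    : ∀ u v → adj u v ≡ adj v u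
    irrefl : ∀ u → adj u u ≡ false
open Graph public

module _ {n : ℕ} (G : Graph n) where

  Adj : Fin n → Fin n → Set
  Adj u v = adj G u v ≡ true

  Path : Fin n → Fin n → ℕ → Set
  Path u v k = Σ (Vec (Fin n) (suc k)) λ p →
      head p ≡ u × last p ≡ v
    × (∀ (i : Fin k) → Adj (lookup p (inject₁ i)) (lookup p (fsuc i)))
    × (∀ i j → lookup p i ≡ lookup p j → i ≡ j)

  Cycle : ℕ → Set
  Cycle k = 2 ≤ k × Σ (Vec (Fin n) (suc k)) λ p →
      (∀ (i : Fin k) → Adj (lookup p (inject₁ i)) (lookup p (fsuc i)))
    × Adj (last p) (head p)
    × (∀ i j → lookup p i ≡ lookup p j → i ≡ j)

  Connected : Set
  Connected = 1 ≤ n × (∀ u v → ∃[ k ] Path u v k)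

  Acyclic : Set
  Acyclic = ∀ k → ¬ Cycle k

  IsTree : Set
  IsTree = Connected × Acyclic

  DiameterAtMost : ℕ → Set
  DiameterAtMost p = ∀ u v → u ≢ v → ∃[ k ] (k ≤ p × Path u v k)

  -- A bipartition, given by a 2-colouring c (X = colour false, Y = colour true)
  -- such that every edge joins X and Y.
  IsBipartition : (Fin n → Bool) → Set
  IsBipartition c = ∀ u v → Adj u v → c u ≢ c v

  Bipartite : Set
  Bipartite = ∃[ c ] IsBipartition c

  anyFin : ∀ {m} → (Fin m → Bool) → Bool
  anyFin {zero} f = false
  anyFin {suc m} f = f Fin.zero ∨ anyFin (λ i → f (fsuc i))

  N : Subset n → Subset n
  N S = tabulate λ v → anyFin λ u → lookup S u ∧ adj G u v

partX : ∀ {n} → (Fin n → Bool) → Subset n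
partX c = tabulate λ v → not (c v)

partY : ∀ {n} → (Fin n → Bool) → Subset n
partY c = tabulate c

record NSEquiv {n m : ℕ} (G : Graph n) (H : Graph m) : Set where
  field
    twoG : 2 ≤ n
    twoH : 2 ≤ m
    cG   : Fin n → Bool
    cH   : Fin m → Bool
    bipG : IsBipartition G cG
    bipH : IsBipartition H cH
    XG≤YG : ∣ partX cG ∣ ≤ ∣ partY cG ∣
    XH≤YH : ∣ partX cH ∣ ≤ ∣ partY cH ∣
    |X|≡ : ∣ partX cG ∣ ≡ ∣ partX cH ∣
    |Y|≡ : ∣ partY cG ∣ ≡ ∣ partY cH ∣
    η    : Subset n → Subset m
    η-into : ∀ S → S ⊆ partX cG → η S ⊆ partX cH
    η-inj  : ∀ S S′ → S ⊆ partX cG → S′ ⊆ partX cG → η S ≡ η S′ → S ≡ S′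
    η-surj : ∀ T → T ⊆ partX cH → ∃[ S ] (S ⊆ partX cG × η S ≡ T)
    η-size : ∀ S → S ⊆ partX cG → ∣ η S ∣ ≡ ∣ S ∣
    η-nbhd : ∀ S → S ⊆ partX cG → ∣ N H (η S) ∣ ≡ ∣ N G S ∣

_≈_ : ∀ {n m} → Graph n → Graph m → Set
G ≈ H = NSEquiv G H

IsHom : ∀ {n t} → Graph n → Graph t → (Fin n → Fin t) → Set
IsHom G T f = ∀ u v → Adj G u v → Adj T (f u) (f v)

isHom? : ∀ {n t} (G : Graph n) (T : Graph t) (f : Fin n → Fin t) → Dec (IsHom G T f)
isHom? G T f = all? λ u → all? λ v → (adj G u v ≟B true) →-dec (adj T (f u) (f v) ≟B true)

allMaps : ∀ t n → List (Vec (Fin t) n)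
allMaps t zero = [ [] ]
allMaps t (suc n) = concatMap (λ x → map (x ∷_) (allMaps t n)) (allFin t)

homCount : ∀ {n t} → Graph n → Graph t → ℕ
homCount {n} {t} G T = length (filter (λ f → isHom? G T (lookup f)) (allMaps t n))

-- Let (X, Y) be the bipartitions supplied by G ≈ H and T a tree. Call a homomorphism f : G → T one-sided if it
-- is constant on X or on Y. A one-sided homomorphism maps G into a star, so by inclusion–exclusion the number of
-- those sending X into U and Y into V depends only on T, U, V, |X| and |Y|.
-- As G has diameter at most 3, two vertices on the same side have a common neighbour, and in a tree two vertices
-- have at most one; hence a two-sided homomorphism has exactly one oriented edge (c, c′) of T with f X ⊆ N(c)
-- and f Y ⊆ N(c′). A homomorphism with f X ⊆ N(c) and f Y ⊆ N(c′) is determined by S = {x ∈ X : f x ≠ c′},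
-- its values on S (in N(c) − c′) and on Y − N(S) (in N(c′)), while N(S) must go to c. Therefore
--   |Hom(G,T)| + Σ_{c∼c′} #one-sided(N(c), N(c′)) = #one-sided + Σ_{c∼c′} Z_G(deg c − 1, deg c′),
-- where Z_G(α, β) = Σ_{S ⊆ X} α^|S| β^(|Y| − |N(S)|) is preserved term by term by the bijection η of G ≈ H.

{-# OPTIONS --safe #-}
module Submission where

open import Data.Bool using (Bool; true; false; not; _∧_; _∨_; if_then_else_)
open import Data.Bool.Properties
  using (not-injective; not-involutive; ¬-not; not-¬; if-not; ∧-assoc; ∧-zeroʳ; ∧-identityʳ) renaming (_≟_ to _≟ᵇ_)
open import Data.Empty using (⊥; ⊥-elim)
open import Data.Fin using (Fin; zero; suc; inject₁)
open import Data.Fin.Properties using (_≟_)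
open import Data.Fin.Subset using (Subset; _⊆_; ∣_∣)
open import Data.Fin.Subset.Properties using (_⊆?_)
open import Data.List using (List; []; _∷_; [_]; _++_; map; concatMap; allFin; filter; length)
open import Data.List.Properties using (map-tabulate)
open import Data.Nat using (ℕ; zero; suc; _+_; _*_; _^_; _∸_; _≤_; z≤n; s≤s)
open import Data.Nat.Properties
  using ( +-identityʳ; +-assoc; +-comm; +-cancelʳ-≡; +-commutativeSemigroup; *-identityˡ; *-identityʳ; *-zeroʳ
        ; *-assoc; *-comm; *-distribˡ-+; *-commutativeSemigroup; m+n∸n≡m)
open import Algebra.Properties.CommutativeSemigroup +-commutativeSemigroup using () renaming (interchange to +-interchange)
open import Algebra.Properties.CommutativeSemigroup *-commutativeSemigroup using () renaming (interchange to *-interchange)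
open import Data.Product using (∃; ∃₂; _×_; _,_; proj₁; proj₂)
open import Data.Sum using (_⊎_; inj₁; inj₂)
open import Data.Vec using (Vec; []; _∷_; lookup; tabulate; head; last)
open import Data.Vec.Properties
  using (≡-dec; lookup∘tabulate; tabulate∘lookup; tabulate-cong; []=⇒lookup; lookup⇒[]=)
open import Data.Vec.Relation.Unary.All using ([]; _∷_)
open import Data.Vec.Relation.Unary.AllPairs using ([]; _∷_)
open import Data.Vec.Relation.Unary.Linked using (Linked; [-]; _∷_)
open import Data.Vec.Relation.Unary.Unique.Propositional using (Unique)
open import Data.Vec.Relation.Unary.Unique.Propositional.Properties using (lookup-injective)
open import Relation.Binary.Definitions using (DecidableEquality)
open import Relation.Binary.PropositionalEquality using (_≡_; _≢_; refl; sym; trans; cong; cong₂; subst; module ≡-Reasoning)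
open import Relation.Nullary using (Dec; yes; no; does)
open import Relation.Nullary.Decidable using (dec-true)
open import Defs hiding (sym)

-- Finite sums

variable
  A B : Set

infix 5 ∑
∑ : List A → (A → ℕ) → ℕ
∑ []       g = 0
∑ (x ∷ xs) g = g x + ∑ xs g

syntax ∑ xs (λ x → e) = ∑[ x ∈ xs ] e

∑-cong : ∀ (xs : List A) {g h : A → ℕ} → (∀ x → g x ≡ h x) → ∑ xs g ≡ ∑ xs h
∑-cong []       eq = refl
∑-cong (x ∷ xs) eq = cong₂ _+_ (eq x) (∑-cong xs eq)

∑-zero : ∀ (xs : List A) → ∑[ x ∈ xs ] 0 ≡ 0
∑-zero []       = refl
∑-zero (x ∷ xs) = ∑-zero xs

∑-distrib-+ : ∀ (xs : List A) (g h : A → ℕ) → ∑[ x ∈ xs ] (g x + h x) ≡ ∑ xs g + ∑ xs h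
∑-distrib-+ []       g h = refl
∑-distrib-+ (x ∷ xs) g h =
  trans (cong ((g x + h x) +_) (∑-distrib-+ xs g h)) (+-interchange (g x) (h x) (∑ xs g) (∑ xs h))

∑-*ˡ : ∀ (xs : List A) k (g : A → ℕ) → ∑[ x ∈ xs ] (k * g x) ≡ k * ∑ xs g
∑-*ˡ []       k g = sym (*-zeroʳ k)
∑-*ˡ (x ∷ xs) k g = trans (cong (k * g x +_) (∑-*ˡ xs k g)) (sym (*-distribˡ-+ k (g x) _))

∑-*ʳ : ∀ (xs : List A) k (g : A → ℕ) → ∑[ x ∈ xs ] (g x * k) ≡ ∑ xs g * k
∑-*ʳ xs k g = trans (∑-cong xs λ x → *-comm (g x) k) (trans (∑-*ˡ xs k g) (*-comm k _))

∑-++ : ∀ (xs ys : List A) (g : A → ℕ) → ∑ (xs ++ ys) g ≡ ∑ xs g + ∑ ys g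
∑-++ []       ys g = refl
∑-++ (x ∷ xs) ys g = trans (cong (g x +_) (∑-++ xs ys g)) (sym (+-assoc (g x) _ _))

∑-map : ∀ (xs : List A) (h : A → B) (g : B → ℕ) → ∑ (map h xs) g ≡ ∑[ x ∈ xs ] g (h x)
∑-map []       h g = refl
∑-map (x ∷ xs) h g = cong (g (h x) +_) (∑-map xs h g)

∑-concatMap : ∀ (xs : List A) (h : A → List B) (g : B → ℕ) → ∑ (concatMap h xs) g ≡ ∑[ x ∈ xs ] ∑ (h x) g
∑-concatMap []       h g = refl
∑-concatMap (x ∷ xs) h g = trans (∑-++ (h x) (concatMap h xs) g) (cong (∑ (h x) g +_) (∑-concatMap xs h g))

∑-comm : ∀ (xs : List A) (ys : List B) (g : A → B → ℕ) →
         ∑[ x ∈ xs ] ∑[ y ∈ ys ] g x y ≡ ∑[ y ∈ ys ] ∑[ x ∈ xs ] g x y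
∑-comm []       ys g = sym (∑-zero ys)
∑-comm (x ∷ xs) ys g = trans (cong (∑ ys (g x) +_) (∑-comm xs ys g)) (sym (∑-distrib-+ ys (g x) _))

∑-allFin-suc : ∀ k (g : Fin (suc k) → ℕ) → ∑ (allFin (suc k)) g ≡ g zero + (∑[ i ∈ allFin k ] g (suc i))
∑-allFin-suc k g =
  cong (g zero +_) (trans (cong (λ xs → ∑ xs g) (sym (map-tabulate (λ i → i) suc))) (∑-map (allFin k) suc g))

𝟙 : Bool → ℕ
𝟙 true  = 1
𝟙 false = 0

𝟙-∧ : ∀ a b → 𝟙 (a ∧ b) ≡ 𝟙 a * 𝟙 b
𝟙-∧ true  b = sym (+-identityʳ (𝟙 b))
𝟙-∧ false b = refl

𝟙-split : ∀ a b w → 𝟙 (a ∧ w) ≡ 𝟙 ((a ∧ b) ∧ w) + 𝟙 ((a ∧ not b) ∧ w)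
𝟙-split false b     w = refl
𝟙-split true  true  w = sym (+-identityʳ (𝟙 w))
𝟙-split true  false w = refl

𝟙-inclusion-exclusion : ∀ h x y w →
  𝟙 ((h ∧ (x ∨ y)) ∧ w) + 𝟙 (h ∧ (x ∧ (y ∧ w))) ≡ 𝟙 (h ∧ (x ∧ w)) + 𝟙 (h ∧ (y ∧ w))
𝟙-inclusion-exclusion false x     y     w     = refl
𝟙-inclusion-exclusion true  true  true  true  = refl
𝟙-inclusion-exclusion true  true  true  false = refl
𝟙-inclusion-exclusion true  true  false w     = refl
𝟙-inclusion-exclusion true  false true  true  = refl
𝟙-inclusion-exclusion true  false true  false = refl
𝟙-inclusion-exclusion true  false false w     = refl

length-filter≡∑ : ∀ {P : A → Set} (P? : (x : A) → Dec (P x)) xs → length (filter P? xs) ≡ ∑[ x ∈ xs ] 𝟙 (does (P? x))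
length-filter≡∑ P? []       = refl
length-filter≡∑ P? (x ∷ xs) with does (P? x)
... | true  = cong suc (length-filter≡∑ P? xs)
... | false = length-filter≡∑ P? xs

bool-ext : ∀ {a b : Bool} → (a ≡ true → b ≡ true) → (b ≡ true → a ≡ true) → a ≡ b
bool-ext {true}  {true}  _ _ = refl
bool-ext {true}  {false} f _ = sym (f refl)
bool-ext {false} {true}  _ g = g refl
bool-ext {false} {false} _ _ = refl

-- Unlike with, this case split does not rewrite (and thereby unfold) the goal.
bool-cases : ∀ {P : Set} b → (b ≡ false → P) → (b ≡ true → P) → P
bool-cases false onFalse onTrue = onFalse refl
bool-cases true  onFalse onTrue = onTrue refl

does-true : ∀ {P : Set} (P? : Dec P) → does P? ≡ true → P
does-true (yes p) _ = p

∧-true⁻ : ∀ {a b : Bool} → a ∧ b ≡ true → a ≡ true × b ≡ true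
∧-true⁻ {true} b≡true = refl , b≡true

∧-true⁺ : ∀ {a b : Bool} → a ≡ true → b ≡ true → a ∧ b ≡ true
∧-true⁺ refl refl = refl

not-∨-true : ∀ {a b : Bool} → not (a ∨ b) ≡ true → a ≡ false × b ≡ false
not-∨-true {false} {false} _ = refl , refl


every : ∀ {k} → (Fin k → Bool) → Bool
every {zero}  p = true
every {suc k} p = p zero ∧ every (λ i → p (suc i))

every⁻ : ∀ {k} {p : Fin k → Bool} → every p ≡ true → ∀ i → p i ≡ true
every⁻ {suc k} all zero    = proj₁ (∧-true⁻ all)
every⁻ {suc k} all (suc i) = every⁻ (proj₂ (∧-true⁻ all)) i

every⁺ : ∀ {k} {p : Fin k → Bool} → (∀ i → p i ≡ true) → every p ≡ true
every⁺ {zero}  all = refl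
every⁺ {suc k} all = ∧-true⁺ (all zero) (every⁺ (λ i → all (suc i)))

every-false : ∀ {k} {p : Fin k → Bool} → every p ≡ false → ∃ λ i → p i ≡ false
every-false {suc k} {p} none with p zero in eq
... | false = zero , eq
... | true  = let i , pi≡false = every-false none in suc i , pi≡false

every-∧ : ∀ {k} (p q : Fin k → Bool) → every (λ i → p i ∧ q i) ≡ every p ∧ every q
every-∧ {k} p q = bool-ext
  (λ both → ∧-true⁺ (every⁺ λ i → proj₁ (∧-true⁻ (every⁻ {p = pq} both i)))
                    (every⁺ λ i → proj₂ (∧-true⁻ {p i} (every⁻ {p = pq} both i))))
  (λ both → every⁺ λ i → ∧-true⁺ (every⁻ {p = p} (proj₁ (∧-true⁻ both)) i)
                                 (every⁻ {p = q} (proj₂ (∧-true⁻ {every p} both)) i))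
  where
  pq : Fin k → Bool
  pq i = p i ∧ q i

every-cong : ∀ {k} {p q : Fin k → Bool} → (∀ i → p i ≡ q i) → every p ≡ every q
every-cong {zero}  eq = refl
every-cong {suc k} eq = cong₂ _∧_ (eq zero) (every-cong (λ i → eq (suc i)))

∏ : ∀ {k} → (Fin k → ℕ) → ℕ
∏ {zero}  g = 1
∏ {suc k} g = g zero * ∏ (λ i → g (suc i))

∏-cong : ∀ {k} {g h : Fin k → ℕ} → (∀ i → g i ≡ h i) → ∏ g ≡ ∏ h
∏-cong {zero}  eq = refl
∏-cong {suc k} eq = cong₂ _*_ (eq zero) (∏-cong (λ i → eq (suc i)))

∏-distrib-* : ∀ {k} (g h : Fin k → ℕ) → ∏ (λ i → g i * h i) ≡ ∏ g * ∏ h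
∏-distrib-* {zero}  g h = refl
∏-distrib-* {suc k} g h = trans (cong (g zero * h zero *_) (∏-distrib-* (λ i → g (suc i)) (λ i → h (suc i))))
                                (*-interchange (g zero) (h zero) _ _)

𝟙-every : ∀ {k} (p : Fin k → Bool) → 𝟙 (every p) ≡ ∏ (λ i → 𝟙 (p i))
𝟙-every {zero}  p = refl
𝟙-every {suc k} p = trans (𝟙-∧ (p zero) _) (cong (𝟙 (p zero) *_) (𝟙-every (λ i → p (suc i))))

vecs : List A → ∀ k → List (Vec A k)
vecs xs zero    = [ [] ]
vecs xs (suc k) = concatMap (λ x → map (x ∷_) (vecs xs k)) xs

allMaps≡vecs : ∀ t k → allMaps t k ≡ vecs (allFin t) k
allMaps≡vecs t zero    = refl
allMaps≡vecs t (suc k) = cong (λ vs → concatMap (λ x → map (x ∷_) vs) (allFin t)) (allMaps≡vecs t k)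

∑-vecs-∏ : ∀ (xs : List A) k (w : Fin k → A → ℕ) →
           ∑[ F ∈ vecs xs k ] ∏ (λ i → w i (lookup F i)) ≡ ∏ (λ i → ∑[ x ∈ xs ] w i x)
∑-vecs-∏ xs zero    w = refl
∑-vecs-∏ xs (suc k) w = begin
  ∑ (concatMap (λ x → map (x ∷_) (vecs xs k)) xs) g
    ≡⟨ ∑-concatMap xs _ g ⟩
  (∑[ x ∈ xs ] ∑ (map (x ∷_) (vecs xs k)) g)
    ≡⟨ ∑-cong xs (λ x → trans (∑-map (vecs xs k) (x ∷_) g) (∑-*ˡ (vecs xs k) (w zero x) _)) ⟩
  (∑[ x ∈ xs ] w zero x * (∑[ F ∈ vecs xs k ] ∏ (λ i → w (suc i) (lookup F i))))
    ≡⟨ ∑-*ʳ xs _ (w zero) ⟩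
  (∑[ x ∈ xs ] w zero x) * (∑[ F ∈ vecs xs k ] ∏ (λ i → w (suc i) (lookup F i)))
    ≡⟨ cong ((∑[ x ∈ xs ] w zero x) *_) (∑-vecs-∏ xs k (λ i → w (suc i))) ⟩
  ∏ (λ i → ∑[ x ∈ xs ] w i x) ∎
  where
  open ≡-Reasoning
  g : Vec _ (suc k) → ℕ
  g F = ∏ (λ i → w i (lookup F i))

module _ {A : Set} (_≟ᴬ_ : DecidableEquality A) where

  ExactlyOnce : List A → Set
  ExactlyOnce xs = ∀ a → ∑[ x ∈ xs ] 𝟙 (does (x ≟ᴬ a)) ≡ 1

  ∑-point : ∀ xs → ExactlyOnce xs → ∀ a (w : A → ℕ) → ∑[ x ∈ xs ] 𝟙 (does (x ≟ᴬ a)) * w x ≡ w a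
  ∑-point xs once a w = begin
    (∑[ x ∈ xs ] 𝟙 (does (x ≟ᴬ a)) * w x) ≡⟨ ∑-cong xs at-a ⟩
    (∑[ x ∈ xs ] 𝟙 (does (x ≟ᴬ a)) * w a) ≡⟨ ∑-*ʳ xs (w a) _ ⟩
    (∑[ x ∈ xs ] 𝟙 (does (x ≟ᴬ a))) * w a ≡⟨ cong (_* w a) (once a) ⟩
    1 * w a                                ≡⟨ *-identityˡ (w a) ⟩
    w a ∎
    where
    open ≡-Reasoning
    at-a : ∀ x → 𝟙 (does (x ≟ᴬ a)) * w x ≡ 𝟙 (does (x ≟ᴬ a)) * w a
    at-a x with x ≟ᴬ a
    ... | yes refl = refl
    ... | no  _    = refl

  ∑-supported : ∀ xs → ExactlyOnce xs → ∀ {a} (p : A → Bool) → (∀ x → p x ≡ true → x ≡ a) →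
                ∑[ x ∈ xs ] 𝟙 (p x) ≡ 𝟙 (p a)
  ∑-supported xs once {a} p only-a = trans (∑-cong xs vanishes-off-a) (∑-point xs once a (λ x → 𝟙 (p x)))
    where
    vanishes-off-a : ∀ x → 𝟙 (p x) ≡ 𝟙 (does (x ≟ᴬ a)) * 𝟙 (p x)
    vanishes-off-a x with x ≟ᴬ a | p x in px
    ... | yes _  | _     = sym (+-identityʳ _)
    ... | no  _  | false = refl
    ... | no x≢a | true  = ⊥-elim (x≢a (only-a x px))

module _ {A B : Set} (_≟ᴬ_ : DecidableEquality A) (_≟ᴮ_ : DecidableEquality B) where

  ∑∑-supported : ∀ xs ys → ExactlyOnce _≟ᴬ_ xs → ExactlyOnce _≟ᴮ_ ys →
                 ∀ {a b} (p : A → B → Bool) → (∀ x y → p x y ≡ true → x ≡ a × y ≡ b) →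
                 ∑[ x ∈ xs ] ∑[ y ∈ ys ] 𝟙 (p x y) ≡ 𝟙 (p a b)
  ∑∑-supported xs ys onceˣ onceʸ {a} {b} p only-ab =
    trans (∑-cong xs λ x → ∑-supported _≟ᴮ_ ys onceʸ (p x) λ y pxy → proj₂ (only-ab x y pxy))
          (∑-supported _≟ᴬ_ xs onceˣ (λ x → p x b) λ x pxb → proj₁ (only-ab x b pxb))

  ∑-reindex : ∀ xs ys → ExactlyOnce _≟ᴬ_ xs → ExactlyOnce _≟ᴮ_ ys →
              ∀ {P : A → Set} {Q : B → Set} (P? : ∀ a → Dec (P a)) (Q? : ∀ b → Dec (Q b)) (η : A → B) →
              (∀ {a} → P a → Q (η a)) →
              (∀ {a a′} → P a → P a′ → η a ≡ η a′ → a ≡ a′) →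
              (∀ {b} → Q b → ∃ λ a → P a × η a ≡ b) →
              ∀ (w : B → ℕ) → ∑[ a ∈ xs ] 𝟙 (does (P? a)) * w (η a) ≡ ∑[ b ∈ ys ] 𝟙 (does (Q? b)) * w b
  ∑-reindex xs ys onceˣ onceʸ {P} {Q} P? Q? η into injective onto w = begin
    (∑[ a ∈ xs ] 𝟙 (does (P? a)) * w (η a))
      ≡⟨ ∑-cong xs (λ a → cong (𝟙 (does (P? a)) *_) (∑-point _≟ᴮ_ ys onceʸ (η a) w)) ⟨
    (∑[ a ∈ xs ] 𝟙 (does (P? a)) * (∑[ b ∈ ys ] 𝟙 (does (b ≟ᴮ η a)) * w b))
      ≡⟨ ∑-cong xs (λ a → sym (∑-*ˡ ys (𝟙 (does (P? a))) _)) ⟩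
    (∑[ a ∈ xs ] ∑[ b ∈ ys ] 𝟙 (does (P? a)) * (𝟙 (does (b ≟ᴮ η a)) * w b))
      ≡⟨ ∑-comm xs ys _ ⟩
    (∑[ b ∈ ys ] ∑[ a ∈ xs ] 𝟙 (does (P? a)) * (𝟙 (does (b ≟ᴮ η a)) * w b))
      ≡⟨ ∑-cong ys (λ b → ∑-cong xs λ a → trans (sym (*-assoc (𝟙 (does (P? a))) _ (w b)))
                                                (cong (_* w b) (sym (𝟙-∧ (does (P? a)) (does (b ≟ᴮ η a)))))) ⟩
    (∑[ b ∈ ys ] ∑[ a ∈ xs ] 𝟙 (does (P? a) ∧ does (b ≟ᴮ η a)) * w b)
      ≡⟨ ∑-cong ys (λ b → trans (∑-*ʳ xs (w b) _) (cong (_* w b) (fibre b))) ⟩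
    (∑[ b ∈ ys ] 𝟙 (does (Q? b)) * w b) ∎
    where
    open ≡-Reasoning
    fibre : ∀ b → ∑[ a ∈ xs ] 𝟙 (does (P? a) ∧ does (b ≟ᴮ η a)) ≡ 𝟙 (does (Q? b))
    fibre b with Q? b
    ... | no ¬Qb = trans (∑-cong xs empty) (∑-zero xs)
      where
      empty : ∀ a → 𝟙 (does (P? a) ∧ does (b ≟ᴮ η a)) ≡ 0
      empty a with P? a | b ≟ᴮ η a
      ... | yes Pa | yes refl = ⊥-elim (¬Qb (into Pa))
      ... | yes _  | no _     = refl
      ... | no _   | _        = refl
    ... | yes Qb with onto Qb
    ... | a₀ , Pa₀ , refl = trans (∑-supported _≟ᴬ_ xs onceˣ _ only-a₀) (at-a₀ (P? a₀) (η a₀ ≟ᴮ η a₀))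
      where
      only-a₀ : ∀ a → does (P? a) ∧ does (η a₀ ≟ᴮ η a) ≡ true → a ≡ a₀
      only-a₀ a hit with P? a | η a₀ ≟ᴮ η a
      ... | yes Pa | yes ηa₀≡ηa = injective Pa Pa₀ (sym ηa₀≡ηa)
      at-a₀ : (d : Dec (P a₀)) (e : Dec (η a₀ ≡ η a₀)) → 𝟙 (does d ∧ does e) ≡ 1
      at-a₀ (yes _)   (yes _)  = refl
      at-a₀ (no ¬Pa₀) _        = ⊥-elim (¬Pa₀ Pa₀)
      at-a₀ (yes _)   (no ≢)   = ⊥-elim (≢ refl)

allFin-once : ∀ k → ExactlyOnce _≟_ (allFin k)
allFin-once (suc k) zero    = trans (∑-allFin-suc k λ i → 𝟙 (does (i ≟ zero))) (cong suc (∑-zero (allFin k)))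
allFin-once (suc k) (suc a) = trans (∑-allFin-suc k λ i → 𝟙 (does (i ≟ suc a))) (allFin-once k a)

vecs-once : ∀ {A : Set} {xs : List A} (_≟ᴬ_ : DecidableEquality A) →
            ExactlyOnce _≟ᴬ_ xs → ∀ k → ExactlyOnce (≡-dec _≟ᴬ_) (vecs xs k)
vecs-once _≟ᴬ_ once zero    [] = refl
vecs-once {A} {xs} _≟ᴬ_ once (suc k) (a ∷ F₀) = begin
  ∑ (concatMap (λ x → map (x ∷_) (vecs xs k)) xs) is-a∷F₀
    ≡⟨ ∑-concatMap xs _ is-a∷F₀ ⟩
  (∑[ x ∈ xs ] ∑ (map (x ∷_) (vecs xs k)) is-a∷F₀)
    ≡⟨ ∑-cong xs (λ x → trans (∑-map (vecs xs k) (x ∷_) is-a∷F₀)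
                              (trans (∑-cong (vecs xs k) λ F → 𝟙-∧ (does (x ≟ᴬ a)) _) (∑-*ˡ (vecs xs k) (𝟙 (does (x ≟ᴬ a))) _))) ⟩
  (∑[ x ∈ xs ] 𝟙 (does (x ≟ᴬ a)) * (∑[ F ∈ vecs xs k ] 𝟙 (does (≡-dec _≟ᴬ_ F F₀))))
    ≡⟨ ∑-cong xs (λ x → cong (𝟙 (does (x ≟ᴬ a)) *_) (vecs-once _≟ᴬ_ once k F₀)) ⟩
  (∑[ x ∈ xs ] 𝟙 (does (x ≟ᴬ a)) * 1)
    ≡⟨ ∑-point _≟ᴬ_ xs once a (λ _ → 1) ⟩
  1 ∎
  where
  open ≡-Reasoning
  is-a∷F₀ : Vec A (suc k) → ℕ
  is-a∷F₀ F = 𝟙 (does (≡-dec _≟ᴬ_ F (a ∷ F₀)))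

subsets : ∀ k → List (Subset k)
subsets = vecs (true ∷ false ∷ [])

subsets-once : ∀ k → ExactlyOnce (≡-dec _≟ᵇ_) (subsets k)
subsets-once = vecs-once _≟ᵇ_ λ { true → refl ; false → refl }

size : ∀ {k} → (Fin k → Bool) → ℕ
size {k} p = ∑[ i ∈ allFin k ] 𝟙 (p i)

size-cong : ∀ {k} {p q : Fin k → Bool} → (∀ i → p i ≡ q i) → size p ≡ size q
size-cong {k} eq = ∑-cong (allFin k) λ i → cong 𝟙 (eq i)

size-suc : ∀ {k} (p : Fin (suc k) → Bool) → size p ≡ 𝟙 (p zero) + size (λ i → p (suc i))
size-suc {k} p = ∑-allFin-suc k λ i → 𝟙 (p i)

∣∣≡size : ∀ {k} (S : Subset k) → ∣ S ∣ ≡ size (lookup S)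
∣∣≡size []          = refl
∣∣≡size (true ∷ S)  = trans (cong suc (∣∣≡size S)) (sym (size-suc (lookup (true ∷ S))))
∣∣≡size (false ∷ S) = trans (∣∣≡size S) (sym (size-suc (lookup (false ∷ S))))

∣tabulate∣≡size : ∀ {k} (p : Fin k → Bool) → ∣ tabulate p ∣ ≡ size p
∣tabulate∣≡size p = trans (∣∣≡size (tabulate p)) (size-cong (lookup∘tabulate p))

⁅_⁆ : ∀ {k} → Fin k → Fin k → Bool
⁅ a ⁆ i = does (i ≟ a)

⁅⁆-true : ∀ {k} {a z : Fin k} → ⁅ a ⁆ z ≡ true → z ≡ a
⁅⁆-true {a = a} {z} = does-true (z ≟ a)

infixr 7 _∩_
infixl 6 _∖_

_∩_ : ∀ {k} → (Fin k → Bool) → (Fin k → Bool) → Fin k → Bool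
(p ∩ q) i = p i ∧ q i

_∖_ : ∀ {k} → (Fin k → Bool) → (Fin k → Bool) → Fin k → Bool
(p ∖ q) i = p i ∧ not (q i)

size-⁅⁆ : ∀ {k} (a : Fin k) → size ⁅ a ⁆ ≡ 1
size-⁅⁆ {k} = allFin-once k

size-∖ : ∀ {k} {p q : Fin k → Bool} → (∀ i → q i ≡ true → p i ≡ true) → size (p ∖ q) + size q ≡ size p
size-∖ {k} {p} {q} q⊆p = trans (sym (∑-distrib-+ (allFin k) _ _)) (∑-cong (allFin k) split)
  where
  split : ∀ i → 𝟙 ((p ∖ q) i) + 𝟙 (q i) ≡ 𝟙 (p i)
  split i with p i in pi | q i in qi
  ... | true  | true  = refl
  ... | true  | false = refl
  ... | false | false = refl
  ... | false | true  = ⊥-elim (not-¬ pi (q⊆p i qi))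

∏-pow : ∀ {k} (p : Fin k → Bool) α → ∏ (λ i → if p i then α else 1) ≡ α ^ size p
∏-pow {zero}  p α = refl
∏-pow {suc k} p α = trans (cong ((if p zero then α else 1) *_) (∏-pow (λ i → p (suc i)) α))
                          (trans (head-factor (p zero)) (cong (α ^_) (sym (size-suc p))))
  where
  head-factor : ∀ b → (if b then α else 1) * α ^ size (λ i → p (suc i)) ≡ α ^ (𝟙 b + size (λ i → p (suc i)))
  head-factor true  = refl
  head-factor false = *-identityˡ _

-- Trees

module _ {k} (K : Graph k) where

  Adj-sym : ∀ {u v} → Adj K u v → Adj K v u
  Adj-sym {u} {v} uv = trans (Graph.sym K v u) uv

  Adj⇒≢ : ∀ {u v} → Adj K u v → u ≢ v
  Adj⇒≢ {u} uu refl with trans (sym uu) (irrefl K u)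
  ... | ()

  Near : Fin k → Fin k → Set
  Near u v = u ≡ v ⊎ ∃ λ w → Adj K u w × Adj K w v

linked-steps : ∀ {R : A → A → Set} {k} {p : Vec A (suc k)} → Linked R p →
               ∀ (i : Fin k) → R (lookup p (inject₁ i)) (lookup p (suc i))
linked-steps {p = _ ∷ _ ∷ _} (r ∷ _)  zero    = r
linked-steps {p = _ ∷ _ ∷ _} (_ ∷ rs) (suc i) = linked-steps rs i

module _ {t} (T : Graph t) (acyclic : Acyclic T) where

  no-cycle : ∀ {k} (p : Vec (Fin t) (suc (suc (suc k)))) →
             Linked (Adj T) p → Adj T (last p) (head p) → Unique p → ⊥
  no-cycle p walk closing distinct =
    acyclic _ (s≤s (s≤s z≤n) , p , linked-steps walk , closing , lookup-injective distinct)

  no-triangle : ∀ {a b c} → Adj T a b → Adj T b c → Adj T c a → ⊥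
  no-triangle ab bc ca = no-cycle (_ ∷ _ ∷ _ ∷ []) (ab ∷ bc ∷ [-]) ca
    ((Adj⇒≢ T ab ∷ (λ a≡c → Adj⇒≢ T ca (sym a≡c)) ∷ []) ∷ (Adj⇒≢ T bc ∷ []) ∷ [] ∷ [])

  no-square : ∀ {a b c d} → a ≢ c → b ≢ d → Adj T a b → Adj T b c → Adj T c d → Adj T d a → ⊥
  no-square a≢c b≢d ab bc cd da = no-cycle (_ ∷ _ ∷ _ ∷ _ ∷ []) (ab ∷ bc ∷ cd ∷ [-]) da
    (  (Adj⇒≢ T ab ∷ a≢c ∷ (λ a≡d → Adj⇒≢ T da (sym a≡d)) ∷ [])
     ∷ (Adj⇒≢ T bc ∷ b≢d ∷ [])
     ∷ (Adj⇒≢ T cd ∷ [])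
     ∷ [] ∷ [])

  common-neighbour-unique : ∀ {a b c d} → a ≢ b → Adj T a c → Adj T c b → Adj T a d → Adj T d b → c ≡ d
  common-neighbour-unique {c = c} {d} a≢b ac cb ad db with c ≟ d
  ... | yes c≡d = c≡d
  ... | no  c≢d = ⊥-elim (no-square a≢b c≢d ac cb (Adj-sym T db) (Adj-sym T ad))

  -- Only a closed walk without backtracking is required: opposite vertices differ as T has no triangles.
  no-hexagon : ∀ {a b c d e f} → Adj T a b → Adj T b c → Adj T c d → Adj T d e → Adj T e f → Adj T f a →
               a ≢ c → b ≢ d → c ≢ e → d ≢ f → e ≢ a → f ≢ b → ⊥
  no-hexagon {a} {b} {c} {d} {e} {f} ab bc cd de ef fa a≢c b≢d c≢e d≢f e≢a f≢b =
    no-cycle (_ ∷ _ ∷ _ ∷ _ ∷ _ ∷ _ ∷ []) (ab ∷ bc ∷ cd ∷ de ∷ ef ∷ [-]) fa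
      (  (Adj⇒≢ T ab ∷ a≢c ∷ a≢d ∷ (λ a≡e → e≢a (sym a≡e)) ∷ (λ a≡f → Adj⇒≢ T fa (sym a≡f)) ∷ [])
       ∷ (Adj⇒≢ T bc ∷ b≢d ∷ b≢e ∷ (λ b≡f → f≢b (sym b≡f)) ∷ [])
       ∷ (Adj⇒≢ T cd ∷ c≢e ∷ c≢f ∷ [])
       ∷ (Adj⇒≢ T de ∷ d≢f ∷ [])
       ∷ (Adj⇒≢ T ef ∷ [])
       ∷ [] ∷ [])
    where
    a≢d : a ≢ d
    a≢d refl = no-triangle ab bc cd
    b≢e : b ≢ e
    b≢e refl = no-triangle bc cd de
    c≢f : c ≢ f
    c≢f refl = no-triangle cd de ef

  adjacent-to-midpoint : ∀ {a b m l} → a ≢ b → Adj T a m → Adj T m b → Near T l a → Near T l b → Adj T l m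
  adjacent-to-midpoint a≢b am mb (inj₁ refl) _ = am
  adjacent-to-midpoint a≢b am mb _ (inj₁ refl) = Adj-sym T mb
  adjacent-to-midpoint {a} {b} {m} {l} a≢b am mb (inj₂ (m₀ , lm₀ , m₀a)) (inj₂ (m₁ , lm₁ , m₁b))
    with l ≟ a | l ≟ b | m₀ ≟ m | m₁ ≟ m | m₀ ≟ m₁
  ... | yes refl | _ | _ | _ | _ = am
  ... | _ | yes refl | _ | _ | _ = Adj-sym T mb
  ... | _ | _ | yes refl | _ | _ = lm₀
  ... | _ | _ | _ | yes refl | _ = lm₁
  ... | _ | _ | no m₀≢m | _ | yes refl =
    ⊥-elim (m₀≢m (common-neighbour-unique a≢b (Adj-sym T m₀a) m₁b am mb))
  ... | no l≢a | no l≢b | no m₀≢m | no m₁≢m | no m₀≢m₁ =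
    ⊥-elim (no-hexagon am mb (Adj-sym T m₁b) (Adj-sym T lm₁) lm₀ m₀a
      a≢b (λ m≡m₁ → m₁≢m (sym m≡m₁)) (λ b≡l → l≢b (sym b≡l)) (λ m₁≡m₀ → m₀≢m₁ (sym m₁≡m₀))
      l≢a m₀≢m)

-- Bipartite graphs of diameter at most 3

module _ {n} (G : Graph n) where

  anyFin-true⁻ : ∀ {m} {p : Fin m → Bool} → anyFin G p ≡ true → ∃ λ u → p u ≡ true
  anyFin-true⁻ {suc m} {p} any with p zero in p0
  ... | true  = zero , p0
  ... | false = let u , pu = anyFin-true⁻ any in suc u , pu

  anyFin-true⁺ : ∀ {m} {p : Fin m → Bool} u → p u ≡ true → anyFin G p ≡ true
  anyFin-true⁺ {suc m} {p} zero    pu = cong (_∨ anyFin G (λ i → p (suc i))) pu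
  anyFin-true⁺ {suc m} {p} (suc u) pu with p zero
  ... | true  = refl
  ... | false = anyFin-true⁺ u pu

  N-true⁻ : ∀ {S v} → lookup (N G S) v ≡ true → ∃ λ u → lookup S u ≡ true × Adj G u v
  N-true⁻ {S} {v} v∈NS =
    let u , hit = anyFin-true⁻ (trans (sym (lookup∘tabulate _ v)) v∈NS) in u , ∧-true⁻ hit

  N-true⁺ : ∀ {S u v} → lookup S u ≡ true → Adj G u v → lookup (N G S) v ≡ true
  N-true⁺ {S} {u} {v} u∈S uv = trans (lookup∘tabulate _ v) (anyFin-true⁺ u (∧-true⁺ u∈S uv))

  private
    another : ∀ {m} → Fin (suc (suc m)) → Fin (suc (suc m))
    another zero    = suc zero
    another (suc _) = zero

    another-≢ : ∀ {m} (u : Fin (suc (suc m))) → another u ≢ u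
    another-≢ zero    ()
    another-≢ (suc _) ()

  connected⇒neighbour : 2 ≤ n → Connected G → ∀ u → ∃ λ w → Adj G u w
  connected⇒neighbour (s≤s (s≤s z≤n)) (_ , path) u with path u (another u)
  ... | 0     , (_ ∷ [])    , refl , u≡another , _ = ⊥-elim (another-≢ u (sym u≡another))
  ... | suc _ , (_ ∷ w ∷ _) , refl , _ , steps , _ = w , steps zero

⊆-partX⁻ : ∀ {n} {side : Fin n → Bool} {S : Subset n} → S ⊆ partX side → ∀ {v} → lookup S v ≡ true → side v ≡ false
⊆-partX⁻ {side = side} {S} S⊆X {v} v∈S =
  not-injective (trans (sym (lookup∘tabulate (λ u → not (side u)) v)) ([]=⇒lookup (S⊆X (lookup⇒[]= v S v∈S))))

⊆-partX⁺ : ∀ {n} {side : Fin n → Bool} {S : Subset n} → (∀ {v} → lookup S v ≡ true → side v ≡ false) → S ⊆ partX side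
⊆-partX⁺ {side = side} {S} inX {v} v∈S =
  lookup⇒[]= v _ (trans (lookup∘tabulate (λ u → not (side u)) v) (cong not (inX ([]=⇒lookup v∈S))))

module _ {n} {G : Graph n} {side : Fin n → Bool} (bip : IsBipartition G side) where

  bipartition-opposite : ∀ {u v} → Adj G u v → side v ≡ not (side u)
  bipartition-opposite {u} {v} uv = ¬-not λ sv≡su → bip u v uv (sym sv≡su)

  diameter3⇒commonNeighbour : DiameterAtMost G 3 → ∀ {u v} → u ≢ v → side u ≡ side v → ∃ λ w → Adj G u w × Adj G w v
  diameter3⇒commonNeighbour diam {u} {v} u≢v su≡sv with diam u v u≢v
  ... | 0 , _ , (_ ∷ []) , refl , refl , _ = ⊥-elim (u≢v refl)
  ... | 1 , _ , (_ ∷ _ ∷ []) , refl , refl , steps , _ = ⊥-elim (bip u v (steps zero) su≡sv)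
  ... | 2 , _ , (_ ∷ w ∷ _ ∷ []) , refl , refl , steps , _ = w , steps zero , steps (suc zero)
  ... | 3 , _ , (_ ∷ w ∷ w′ ∷ _ ∷ []) , refl , refl , steps , _ = ⊥-elim (not-¬ (sym su≡sv) odd-path)
    where
    odd-path : side v ≡ not (side u)
    odd-path = begin
      side v             ≡⟨ bipartition-opposite (steps (suc (suc zero))) ⟩
      not (side w′)      ≡⟨ cong not (bipartition-opposite (steps (suc zero))) ⟩
      not (not (side w)) ≡⟨ not-involutive (side w) ⟩
      side w             ≡⟨ bipartition-opposite (steps zero) ⟩
      not (side u)       ∎
      where open ≡-Reasoning
  ... | suc (suc (suc (suc _))) , s≤s (s≤s (s≤s ())) , _

record Diam3Bipartition {n} (G : Graph n) (side : Fin n → Bool) : Set where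
  field
    bipartition     : IsBipartition G side
    neighbour       : ∀ u → ∃ λ w → Adj G u w
    commonNeighbour : ∀ {u v} → u ≢ v → side u ≡ side v → ∃ λ w → Adj G u w × Adj G w v
    x₀              : Fin n
    x₀∈X            : side x₀ ≡ false
    y₀              : Fin n
    y₀∈Y            : side y₀ ≡ true

  opposite : ∀ {u v b} → Adj G u v → side u ≡ b → side v ≡ not b
  opposite uv su = trans (bipartition-opposite {G = G} bipartition uv) (cong not su)

  Near-same-side : ∀ {u v} → side u ≡ side v → Near G u v
  Near-same-side {u} {v} su≡sv with u ≟ v
  ... | yes u≡v = inj₁ u≡v
  ... | no  u≢v = inj₂ (commonNeighbour u≢v su≡sv)

swapSides : ∀ {n} {G : Graph n} {side} → Diam3Bipartition G side → Diam3Bipartition G (λ v → not (side v))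
swapSides D = record
  { bipartition     = λ u v uv su≡sv → bipartition u v uv (not-injective su≡sv)
  ; neighbour       = neighbour
  ; commonNeighbour = λ u≢v su≡sv → commonNeighbour u≢v (not-injective su≡sv)
  ; x₀ = y₀ ; x₀∈X = cong not y₀∈Y
  ; y₀ = x₀ ; y₀∈Y = cong not x₀∈X
  }
  where open Diam3Bipartition D

diam3Bipartition : ∀ {n} {G : Graph n} {side} → 2 ≤ n → Connected G → IsBipartition G side → DiameterAtMost G 3 →
                   Diam3Bipartition G side
diam3Bipartition {G = G} {side} 2≤n@(s≤s (s≤s z≤n)) conn bip diam = record
  { bipartition     = bip
  ; neighbour       = neighbour
  ; commonNeighbour = diameter3⇒commonNeighbour {G = G} bip diam
  ; x₀ = proj₁ (proj₁ ends) ; x₀∈X = proj₂ (proj₁ ends)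
  ; y₀ = proj₁ (proj₂ ends) ; y₀∈Y = proj₂ (proj₂ ends)
  }
  where
  neighbour : ∀ u → ∃ λ w → Adj G u w
  neighbour = connected⇒neighbour G 2≤n conn
  ends : (∃ λ x → side x ≡ false) × (∃ λ y → side y ≡ true)
  ends with neighbour zero | side zero in s0
  ... | w , 0w | false = (zero , s0) , (w , trans (bipartition-opposite {G = G} bip 0w) (cong not s0))
  ... | w , 0w | true  = (w , trans (bipartition-opposite {G = G} bip 0w) (cong not s0)) , (zero , s0)

-- Counting homomorphisms into a tree

Map : ℕ → ℕ → Set
Map n t = Fin n → Fin t

#maps : ∀ {n t} → (Map n t → Bool) → ℕ
#maps {n} {t} P = ∑[ F ∈ allMaps t n ] 𝟙 (P (lookup F))

#maps-∧ˡ : ∀ {n t} b (P : Map n t → Bool) → #maps (λ f → b ∧ P f) ≡ 𝟙 b * #maps P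
#maps-∧ˡ {n} {t} b P = trans (∑-cong (allMaps t n) λ F → 𝟙-∧ b (P (lookup F))) (∑-*ˡ (allMaps t n) (𝟙 b) _)

#maps-every : ∀ {n t} (A : Fin n → Fin t → Bool) → #maps (λ f → every λ v → A v (f v)) ≡ ∏ λ v → size (A v)
#maps-every {n} {t} A = begin
  (∑[ F ∈ allMaps t n ] 𝟙 (every λ v → A v (lookup F v)))
    ≡⟨ cong (λ Fs → ∑[ F ∈ Fs ] 𝟙 (every λ v → A v (lookup F v))) (allMaps≡vecs t n) ⟩
  (∑[ F ∈ vecs (allFin t) n ] 𝟙 (every λ v → A v (lookup F v)))
    ≡⟨ ∑-cong (vecs (allFin t) n) (λ F → 𝟙-every λ v → A v (lookup F v)) ⟩
  (∑[ F ∈ vecs (allFin t) n ] ∏ λ v → 𝟙 (A v (lookup F v)))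
    ≡⟨ ∑-vecs-∏ (allFin t) n (λ v z → 𝟙 (A v z)) ⟩
  (∏ λ v → size (A v)) ∎
  where open ≡-Reasoning

Z : ∀ {n} → Graph n → (Fin n → Bool) → ℕ → ℕ → ℕ
Z {n} G side α β = ∑[ S ∈ subsets n ] 𝟙 (does (S ⊆? partX side)) * (α ^ ∣ S ∣ * β ^ (∣ partY side ∣ ∸ ∣ N G S ∣))

module Side {n t} {G : Graph n} {side : Fin n → Bool} (D : Diam3Bipartition G side) (T : Graph t) where
  open Diam3Bipartition D

  Within : (Fin t → Bool) → (Fin t → Bool) → Map n t → Bool
  Within U V f = every λ v → (if side v then V else U) (f v)

  AroundEdge : Fin t → Fin t → Map n t → Bool
  AroundEdge c c′ = Within (adj T c) (adj T c′)

  module _ {U V : Fin t → Bool} {f : Map n t} where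

    Within⁻ : Within U V f ≡ true → ∀ v → (if side v then V else U) (f v) ≡ true
    Within⁻ = every⁻ {p = λ v → (if side v then V else U) (f v)}

    Within-X : Within U V f ≡ true → ∀ {v} → side v ≡ false → U (f v) ≡ true
    Within-X w {v} v∈X = subst (λ s → (if s then V else U) (f v) ≡ true) v∈X (Within⁻ w v)

    Within-Y : Within U V f ≡ true → ∀ {v} → side v ≡ true → V (f v) ≡ true
    Within-Y w {v} v∈Y = subst (λ s → (if s then V else U) (f v) ≡ true) v∈Y (Within⁻ w v)

    Within⁺ : (∀ {v} → side v ≡ false → U (f v) ≡ true) → (∀ {v} → side v ≡ true → V (f v) ≡ true) →
              Within U V f ≡ true
    Within⁺ inX inY = every⁺ at
      where
      at : ∀ v → (if side v then V else U) (f v) ≡ true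
      at v with side v in sv
      ... | false = inX sv
      ... | true  = inY sv

  Within-∩ : ∀ U U′ V V′ f → Within (U ∩ U′) (V ∩ V′) f ≡ Within U V f ∧ Within U′ V′ f
  Within-∩ U U′ V V′ f =
    trans (every-cong at) (every-∧ (λ v → (if side v then V else U) (f v)) (λ v → (if side v then V′ else U′) (f v)))
    where
    at : ∀ v → (if side v then V ∩ V′ else U ∩ U′) (f v)
             ≡ (if side v then V else U) (f v) ∧ (if side v then V′ else U′) (f v)
    at v with side v
    ... | false = refl
    ... | true  = refl

  ConstX : Map n t → Bool
  ConstX f = Within ⁅ f x₀ ⁆ (λ _ → true) f

  nonconstant : ∀ {f} → ConstX f ≡ false → ∃ λ x₁ → side x₁ ≡ false × f x₁ ≢ f x₀
  nonconstant {f} notConst with every-false {p = λ v → (if side v then (λ _ → true) else ⁅ f x₀ ⁆) (f v)} notConst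
  ... | v , off = v , off-point (side v) off
    where
    off-point : ∀ b → (if b then (λ _ → true) else ⁅ f x₀ ⁆) (f v) ≡ false → b ≡ false × f v ≢ f x₀
    off-point false off = refl , λ fv≡fx₀ → not-¬ (dec-true (f v ≟ f x₀) fv≡fx₀) off

  isHom : Map n t → Bool
  isHom f = does (isHom? G T f)

  IsHom-fromX : ∀ {f} → (∀ {x y} → side x ≡ false → Adj G x y → Adj T (f x) (f y)) → IsHom G T f
  IsHom-fromX {f} fromX u v uv with side u in su
  ... | false = fromX su uv
  ... | true  = Adj-sym T (fromX (opposite uv su) (Adj-sym G uv))

  hom-point : ∀ a f → isHom f ∧ Within ⁅ a ⁆ (λ _ → true) f ≡ Within ⁅ a ⁆ (adj T a) f
  hom-point a f = bool-ext to from
    where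
    to : isHom f ∧ Within ⁅ a ⁆ (λ _ → true) f ≡ true → Within ⁅ a ⁆ (adj T a) f ≡ true
    to homAndPoint = Within⁺ (Within-X point) inN
      where
      hom : IsHom G T f
      hom = does-true (isHom? G T f) (proj₁ (∧-true⁻ homAndPoint))
      point : Within ⁅ a ⁆ (λ _ → true) f ≡ true
      point = proj₂ (∧-true⁻ {isHom f} homAndPoint)
      inN : ∀ {y} → side y ≡ true → adj T a (f y) ≡ true
      inN {y} y∈Y with neighbour y
      ... | x , yx = subst (λ z → Adj T z (f y)) (⁅⁆-true (Within-X point (opposite yx y∈Y)))
                           (Adj-sym T (hom y x yx))
    from : Within ⁅ a ⁆ (adj T a) f ≡ true → isHom f ∧ Within ⁅ a ⁆ (λ _ → true) f ≡ true
    from star = ∧-true⁺ (dec-true (isHom? G T f) (IsHom-fromX edge)) (Within⁺ (Within-X star) (λ _ → refl))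
      where
      edge : ∀ {x y} → side x ≡ false → Adj G x y → Adj T (f x) (f y)
      edge {x} {y} x∈X xy = subst (λ z → Adj T z (f y)) (sym (⁅⁆-true (Within-X star x∈X)))
                                  (Within-Y star (opposite xy x∈X))

  const-split : ∀ U V f → 𝟙 (ConstX f ∧ Within U V f) ≡ ∑[ a ∈ allFin t ] 𝟙 (Within (⁅ a ⁆ ∩ U) V f)
  const-split U V f = sym (trans (∑-cong (allFin t) λ a → cong 𝟙 (Within-∩ ⁅ a ⁆ U (λ _ → true) V f))
                                 (∑-supported _≟_ (allFin t) (allFin-once t) _ only-fx₀))
    where
    only-fx₀ : ∀ a → Within ⁅ a ⁆ (λ _ → true) f ∧ Within U V f ≡ true → a ≡ f x₀
    only-fx₀ a both = sym (⁅⁆-true (Within-X (proj₁ (∧-true⁻ both)) x₀∈X))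

  hom-const : ∀ U V f → 𝟙 (isHom f ∧ (ConstX f ∧ Within U V f))
                        ≡ ∑[ a ∈ allFin t ] 𝟙 (Within (⁅ a ⁆ ∩ U) (adj T a ∩ V) f)
  hom-const U V f = begin
    𝟙 (isHom f ∧ (ConstX f ∧ Within U V f))
      ≡⟨ trans (𝟙-∧ (isHom f) _) (cong (𝟙 (isHom f) *_) (const-split U V f)) ⟩
    𝟙 (isHom f) * (∑[ a ∈ allFin t ] 𝟙 (Within (⁅ a ⁆ ∩ U) V f))
      ≡⟨ sym (∑-*ˡ (allFin t) (𝟙 (isHom f)) _) ⟩
    (∑[ a ∈ allFin t ] 𝟙 (isHom f) * 𝟙 (Within (⁅ a ⁆ ∩ U) V f))
      ≡⟨ ∑-cong (allFin t) (λ a → trans (sym (𝟙-∧ (isHom f) _)) (cong 𝟙 (at a))) ⟩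
    (∑[ a ∈ allFin t ] 𝟙 (Within (⁅ a ⁆ ∩ U) (adj T a ∩ V) f)) ∎
    where
    open ≡-Reasoning
    at : ∀ a → isHom f ∧ Within (⁅ a ⁆ ∩ U) V f ≡ Within (⁅ a ⁆ ∩ U) (adj T a ∩ V) f
    at a = begin
      isHom f ∧ Within (⁅ a ⁆ ∩ U) V f
        ≡⟨ cong (isHom f ∧_) (Within-∩ ⁅ a ⁆ U (λ _ → true) V f) ⟩
      isHom f ∧ (Within ⁅ a ⁆ (λ _ → true) f ∧ Within U V f)
        ≡⟨ sym (∧-assoc (isHom f) _ _) ⟩
      (isHom f ∧ Within ⁅ a ⁆ (λ _ → true) f) ∧ Within U V f
        ≡⟨ cong (_∧ Within U V f) (hom-point a f) ⟩
      Within ⁅ a ⁆ (adj T a) f ∧ Within U V f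
        ≡⟨ sym (Within-∩ ⁅ a ⁆ U (adj T a) V f) ⟩
      Within (⁅ a ⁆ ∩ U) (adj T a ∩ V) f ∎

  #Within : ∀ U V → #maps (Within U V) ≡ size U ^ size (λ v → not (side v)) * size V ^ size side
  #Within U V = begin
    #maps (Within U V)
      ≡⟨ #maps-every (λ v → if side v then V else U) ⟩
    ∏ (λ v → size (if side v then V else U))
      ≡⟨ ∏-cong split ⟩
    ∏ (λ v → (if not (side v) then size U else 1) * (if side v then size V else 1))
      ≡⟨ ∏-distrib-* (λ v → if not (side v) then size U else 1) (λ v → if side v then size V else 1) ⟩
    ∏ (λ v → if not (side v) then size U else 1) * ∏ (λ v → if side v then size V else 1)
      ≡⟨ cong₂ _*_ (∏-pow (λ v → not (side v)) (size U)) (∏-pow side (size V)) ⟩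
    size U ^ size (λ v → not (side v)) * size V ^ size side ∎
    where
    open ≡-Reasoning
    split : ∀ v → size (if side v then V else U) ≡ (if not (side v) then size U else 1) * (if side v then size V else 1)
    split v with side v
    ... | false = sym (*-identityʳ (size U))
    ... | true  = sym (*-identityˡ (size V))

  Near-hom : ∀ {f u v} → IsHom G T f → Near G u v → Near T (f u) (f v)
  Near-hom hom (inj₁ refl)          = inj₁ refl
  Near-hom hom (inj₂ (w , uw , wv)) = inj₂ (_ , hom _ _ uw , hom _ _ wv)

  module _ (acyclic : Acyclic T) where

    centre : ∀ {f} → IsHom G T f → ConstX f ≡ false →
             ∃ λ w → side w ≡ true × Within (adj T (f w)) (λ _ → true) f ≡ true
    centre {f} hom notConst with nonconstant notConst
    ... | x₁ , x₁∈X , fx₁≢fx₀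
      with commonNeighbour (λ x₀≡x₁ → fx₁≢fx₀ (cong f (sym x₀≡x₁))) (trans x₀∈X (sym x₁∈X))
    ... | w , x₀w , wx₁ = w , opposite x₀w x₀∈X , Within⁺ inN (λ _ → refl)
      where
      inN : ∀ {x} → side x ≡ false → adj T (f w) (f x) ≡ true
      inN x∈X = Adj-sym T (adjacent-to-midpoint T acyclic (λ fx₀≡fx₁ → fx₁≢fx₀ (sym fx₀≡fx₁))
                  (hom _ _ x₀w) (hom _ _ wx₁)
                  (Near-hom hom (Near-same-side (trans x∈X (sym x₀∈X))))
                  (Near-hom hom (Near-same-side (trans x∈X (sym x₁∈X)))))

    centre-unique : ∀ {f c d V V′} → ConstX f ≡ false →
                    Within (adj T c) V f ≡ true → Within (adj T d) V′ f ≡ true → c ≡ d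
    centre-unique {f} notConst around-c around-d with nonconstant notConst
    ... | x₁ , x₁∈X , fx₁≢fx₀ =
      common-neighbour-unique T acyclic (λ fx₀≡fx₁ → fx₁≢fx₀ (sym fx₀≡fx₁))
        (Adj-sym T (Within-X around-c x₀∈X)) (Within-X around-c x₁∈X)
        (Adj-sym T (Within-X around-d x₀∈X)) (Within-X around-d x₁∈X)

    module EdgeStar {c c′} (cc′ : Adj T c c′) where

      -- Where a homomorphism around the edge (c, c′) may send v, given that S ⊆ X is the set of X-vertices
      -- it does not send to c′.
      slot : Subset n → Fin n → Fin t → Bool
      slot S v = if side v then (if lookup (N G S) v then ⁅ c ⁆ else adj T c′)
                           else (if lookup S v then adj T c ∖ ⁅ c′ ⁆ else ⁅ c′ ⁆)

      Fits : Subset n → Map n t → Bool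
      Fits S f = every λ v → slot S v (f v)

      fibre : Map n t → Subset n
      fibre f = tabulate λ v → not (side v) ∧ not (⁅ c′ ⁆ (f v))

      module _ (S : Subset n) {v : Fin n} where
        slot-X∈S : side v ≡ false → lookup S v ≡ true → ∀ z → slot S v z ≡ (adj T c ∖ ⁅ c′ ⁆) z
        slot-X∈S sv Sv z rewrite sv | Sv = refl

        slot-X∉S : side v ≡ false → lookup S v ≡ false → ∀ z → slot S v z ≡ ⁅ c′ ⁆ z
        slot-X∉S sv Sv z rewrite sv | Sv = refl

        slot-Y∈N : side v ≡ true → lookup (N G S) v ≡ true → ∀ z → slot S v z ≡ ⁅ c ⁆ z
        slot-Y∈N sv Nv z rewrite sv | Nv = refl

        slot-Y∉N : side v ≡ true → lookup (N G S) v ≡ false → ∀ z → slot S v z ≡ adj T c′ z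
        slot-Y∉N sv Nv z rewrite sv | Nv = refl

      fits-at : ∀ S {f} → Fits S f ≡ true → ∀ {v} {A : Fin t → Bool} → (∀ z → slot S v z ≡ A z) → A (f v) ≡ true
      fits-at S {f} fits {v} slot≡A = trans (sym (slot≡A (f v))) (every⁻ {p = λ v → slot S v (f v)} fits v)

      N⊆Y : ∀ {S} → S ⊆ partX side → ∀ {v} → lookup (N G S) v ≡ true → side v ≡ true
      N⊆Y {S} S⊆X v∈NS with N-true⁻ G {S} v∈NS
      ... | u , u∈S , uv = opposite uv (⊆-partX⁻ S⊆X u∈S)

      fits⇒fibre : ∀ {S f} → S ⊆ partX side → Fits S f ≡ true → S ≡ fibre f
      fits⇒fibre {S} {f} S⊆X fits = trans (sym (tabulate∘lookup S)) (tabulate-cong at)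
        where
        at : ∀ v → lookup S v ≡ not (side v) ∧ not (⁅ c′ ⁆ (f v))
        at v with side v in sv | lookup S v in Sv
        ... | true  | true  = ⊥-elim (not-¬ (⊆-partX⁻ S⊆X Sv) sv)
        ... | true  | false = refl
        ... | false | true  = sym (proj₂ (∧-true⁻ (fits-at S fits (slot-X∈S S sv Sv))))
        ... | false | false = cong not (sym (fits-at S fits (slot-X∉S S sv Sv)))

      fits⇒within : ∀ S {f} → Fits S f ≡ true → AroundEdge c c′ f ≡ true
      fits⇒within S {f} fits = Within⁺ inX inY
        where
        inX : ∀ {v} → side v ≡ false → adj T c (f v) ≡ true
        inX {v} sv with lookup S v in Sv
        ... | true  = proj₁ (∧-true⁻ (fits-at S fits (slot-X∈S S sv Sv)))
        ... | false = subst (Adj T c) (sym (⁅⁆-true (fits-at S fits (slot-X∉S S sv Sv)))) cc′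
        inY : ∀ {v} → side v ≡ true → adj T c′ (f v) ≡ true
        inY {v} sv with lookup (N G S) v in Nv
        ... | true  = subst (Adj T c′) (sym (⁅⁆-true (fits-at S fits (slot-Y∈N S sv Nv)))) (Adj-sym T cc′)
        ... | false = fits-at S fits (slot-Y∉N S sv Nv)

      fits⇒hom : ∀ S {f} → Fits S f ≡ true → IsHom G T f
      fits⇒hom S {f} fits = IsHom-fromX edge
        where
        edge : ∀ {x y} → side x ≡ false → Adj G x y → Adj T (f x) (f y)
        edge {x} {y} sx xy with lookup S x in Sx
        ... | true  = subst (Adj T (f x))
                        (sym (⁅⁆-true (fits-at S fits (slot-Y∈N S sy (N-true⁺ G {S} Sx xy)))))
                        (Adj-sym T (Within-X (fits⇒within S fits) sx))
          where
          sy : side y ≡ true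
          sy = opposite xy sx
        ... | false = subst (λ z → Adj T z (f y))
                        (sym (⁅⁆-true (fits-at S fits (slot-X∉S S sx Sx))))
                        (Within-Y (fits⇒within S fits) (opposite xy sx))

      fibre⊆X : ∀ f → fibre f ⊆ partX side
      fibre⊆X f = ⊆-partX⁺ λ {v} v∈fibre →
        not-injective (proj₁ (∧-true⁻ (trans (sym (lookup∘tabulate _ v)) v∈fibre)))

      hom-within⇒fits : ∀ {f} → IsHom G T f → AroundEdge c c′ f ≡ true → Fits (fibre f) f ≡ true
      hom-within⇒fits {f} hom within = every⁺ at
        where
        fibre-at : ∀ v → lookup (fibre f) v ≡ not (side v) ∧ not (⁅ c′ ⁆ (f v))
        fibre-at v = lookup∘tabulate _ v
        -- f v and c are both common neighbours of c′ and of f u ≠ c′.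
        next-to-fibre : ∀ {v} → side v ≡ true → lookup (N G (fibre f)) v ≡ true → f v ≡ c
        next-to-fibre {v} sv Nv with N-true⁻ G {fibre f} Nv
        ... | u , u∈fibre , uv =
          common-neighbour-unique T acyclic fu≢c′ (hom u v uv) (Adj-sym T (Within-Y within sv))
                                                  (Adj-sym T (Within-X within u∈X)) cc′
          where
          u∈fibre′ : not (side u) ≡ true × not (⁅ c′ ⁆ (f u)) ≡ true
          u∈fibre′ = ∧-true⁻ (trans (sym (fibre-at u)) u∈fibre)
          u∈X : side u ≡ false
          u∈X = not-injective (proj₁ u∈fibre′)
          fu≢c′ : f u ≢ c′
          fu≢c′ fu≡c′ = not-¬ (dec-true (f u ≟ c′) fu≡c′) (not-injective (proj₂ u∈fibre′))
        at : ∀ v → slot (fibre f) v (f v) ≡ true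
        at v = bool-cases (side v) atX atY
          where
          atX : side v ≡ false → slot (fibre f) v (f v) ≡ true
          atX sv = bool-cases (⁅ c′ ⁆ (f v))
            (λ hit → trans (slot-X∈S (fibre f) sv (trans (fibre-at v) (cong₂ (λ s h → not s ∧ not h) sv hit)) (f v))
                           (∧-true⁺ (Within-X within sv) (cong not hit)))
            (λ hit → trans (slot-X∉S (fibre f) sv (trans (fibre-at v) (cong₂ (λ s h → not s ∧ not h) sv hit)) (f v)) hit)
          atY : side v ≡ true → slot (fibre f) v (f v) ≡ true
          atY sv = bool-cases (lookup (N G (fibre f)) v)
            (λ Nv → trans (slot-Y∉N (fibre f) sv Nv (f v)) (Within-Y within sv))
            (λ Nv → trans (slot-Y∈N (fibre f) sv Nv (f v)) (dec-true (f v ≟ c) (next-to-fibre sv Nv)))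

      α β : ℕ
      α = size (adj T c ∖ ⁅ c′ ⁆)
      β = size (adj T c′)

      hom-within≡∑fits : ∀ f → 𝟙 (isHom f ∧ AroundEdge c c′ f)
                               ≡ ∑[ S ∈ subsets n ] 𝟙 (does (S ⊆? partX side) ∧ Fits S f)
      hom-within≡∑fits f =
        sym (trans (∑-supported (≡-dec _≟ᵇ_) (subsets n) (subsets-once n) _ only-fibre) (cong 𝟙 (bool-ext to from)))
        where
        only-fibre : ∀ S → does (S ⊆? partX side) ∧ Fits S f ≡ true → S ≡ fibre f
        only-fibre S hit = let S⊆X , fits = ∧-true⁻ hit in fits⇒fibre (does-true (S ⊆? partX side) S⊆X) fits
        to : does (fibre f ⊆? partX side) ∧ Fits (fibre f) f ≡ true → isHom f ∧ AroundEdge c c′ f ≡ true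
        to hit = let fits = proj₂ (∧-true⁻ {does (fibre f ⊆? partX side)} hit) in
                 ∧-true⁺ (dec-true (isHom? G T f) (fits⇒hom (fibre f) fits)) (fits⇒within (fibre f) fits)
        from : isHom f ∧ AroundEdge c c′ f ≡ true → does (fibre f ⊆? partX side) ∧ Fits (fibre f) f ≡ true
        from hit = let hom , within = ∧-true⁻ hit in
                   ∧-true⁺ (dec-true (fibre f ⊆? partX side) (fibre⊆X f)) (hom-within⇒fits (does-true (isHom? G T f) hom) within)

      #Fits : ∀ {S} → S ⊆ partX side → #maps (Fits S) ≡ α ^ ∣ S ∣ * β ^ (∣ partY side ∣ ∸ ∣ N G S ∣)
      #Fits {S} S⊆X = begin
        #maps (Fits S)
          ≡⟨ #maps-every (slot S) ⟩
        ∏ (λ v → size (slot S v))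
          ≡⟨ ∏-cong size-slot ⟩
        ∏ (λ v → (if lookup S v then α else 1) * (if (side ∖ lookup (N G S)) v then β else 1))
          ≡⟨ ∏-distrib-* (λ v → if lookup S v then α else 1) (λ v → if (side ∖ lookup (N G S)) v then β else 1) ⟩
        ∏ (λ v → if lookup S v then α else 1) * ∏ (λ v → if (side ∖ lookup (N G S)) v then β else 1)
          ≡⟨ cong₂ _*_ (∏-pow (lookup S) α) (∏-pow (side ∖ lookup (N G S)) β) ⟩
        α ^ size (lookup S) * β ^ size (side ∖ lookup (N G S))
          ≡⟨ cong₂ (λ s r → α ^ s * β ^ r) (sym (∣∣≡size S)) outside-N ⟩
        α ^ ∣ S ∣ * β ^ (∣ partY side ∣ ∸ ∣ N G S ∣) ∎
        where
        open ≡-Reasoning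
        size-slot : ∀ v → size (slot S v) ≡ (if lookup S v then α else 1) * (if (side ∖ lookup (N G S)) v then β else 1)
        size-slot v with side v in sv | lookup S v in Sv | lookup (N G S) v in Nv
        ... | false | true  | _     = sym (*-identityʳ α)
        ... | false | false | _     = size-⁅⁆ c′
        ... | true  | true  | _     = ⊥-elim (not-¬ (⊆-partX⁻ S⊆X Sv) sv)
        ... | true  | false | true  = size-⁅⁆ c
        ... | true  | false | false = sym (*-identityˡ β)
        outside-N : size (side ∖ lookup (N G S)) ≡ ∣ partY side ∣ ∸ ∣ N G S ∣
        outside-N = begin
          size (side ∖ lookup (N G S))
            ≡⟨ sym (m+n∸n≡m _ (size (lookup (N G S)))) ⟩
          size (side ∖ lookup (N G S)) + size (lookup (N G S)) ∸ size (lookup (N G S))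
            ≡⟨ cong₂ _∸_ (size-∖ {p = side} {q = lookup (N G S)} (λ v → N⊆Y S⊆X {v})) (sym (∣∣≡size (N G S))) ⟩
          size side ∸ ∣ N G S ∣
            ≡⟨ cong (_∸ ∣ N G S ∣) (sym (∣tabulate∣≡size side)) ⟩
          ∣ partY side ∣ ∸ ∣ N G S ∣ ∎

      #hom-within : #maps (λ f → isHom f ∧ AroundEdge c c′ f) ≡ Z G side α β
      #hom-within = begin
        (∑[ F ∈ allMaps t n ] 𝟙 (isHom (lookup F) ∧ AroundEdge c c′ (lookup F)))
          ≡⟨ ∑-cong (allMaps t n) (λ F → hom-within≡∑fits (lookup F)) ⟩
        (∑[ F ∈ allMaps t n ] ∑[ S ∈ subsets n ] 𝟙 (does (S ⊆? partX side) ∧ Fits S (lookup F)))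
          ≡⟨ ∑-comm (allMaps t n) (subsets n) _ ⟩
        (∑[ S ∈ subsets n ] #maps (λ f → does (S ⊆? partX side) ∧ Fits S f))
          ≡⟨ ∑-cong (subsets n) (λ S → trans (#maps-∧ˡ _ (Fits S)) (count S)) ⟩
        Z G side α β ∎
        where
        open ≡-Reasoning
        count : ∀ S → 𝟙 (does (S ⊆? partX side)) * #maps (Fits S)
                    ≡ 𝟙 (does (S ⊆? partX side)) * (α ^ ∣ S ∣ * β ^ (∣ partY side ∣ ∸ ∣ N G S ∣))
        count S with S ⊆? partX side
        ... | yes S⊆X = cong (1 *_) (#Fits S⊆X)
        ... | no  _   = refl

module _ {t} (T : Graph t) where

  boxCount : ℕ → ℕ → (Fin t → Bool) → (Fin t → Bool) → ℕ
  boxCount x y U V = size U ^ x * size V ^ y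

  constXCount constYCount bothCount : ℕ → ℕ → (Fin t → Bool) → (Fin t → Bool) → ℕ
  constXCount x y U V = ∑[ a ∈ allFin t ] boxCount x y (⁅ a ⁆ ∩ U) (adj T a ∩ V)
  constYCount x y U V = ∑[ b ∈ allFin t ] boxCount x y (adj T b ∩ U) (⁅ b ⁆ ∩ V)
  bothCount   x y U V = ∑[ b ∈ allFin t ] constXCount x y U (⁅ b ⁆ ∩ V)

  edgeSum : (Fin t → Fin t → ℕ) → ℕ
  edgeSum g = ∑[ c ∈ allFin t ] ∑[ c′ ∈ allFin t ] 𝟙 (adj T c c′) * g c c′

  edgeSum-cong : ∀ {g h : Fin t → Fin t → ℕ} → (∀ {c c′} → Adj T c c′ → g c c′ ≡ h c c′) → edgeSum g ≡ edgeSum h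
  edgeSum-cong {g} {h} eq = ∑-cong (allFin t) λ c → ∑-cong (allFin t) λ c′ → on-edges c c′
    where
    on-edges : ∀ c c′ → 𝟙 (adj T c c′) * g c c′ ≡ 𝟙 (adj T c c′) * h c c′
    on-edges c c′ with adj T c c′ in cc′
    ... | true  = cong (1 *_) (eq cc′)
    ... | false = refl

  edgeSum-distrib-+ : ∀ (g h : Fin t → Fin t → ℕ) → edgeSum (λ c c′ → g c c′ + h c c′) ≡ edgeSum g + edgeSum h
  edgeSum-distrib-+ g h =
    trans (∑-cong (allFin t) λ c → trans (∑-cong (allFin t) λ c′ → *-distribˡ-+ (𝟙 (adj T c c′)) (g c c′) (h c c′))
                                         (∑-distrib-+ (allFin t) _ _))
          (∑-distrib-+ (allFin t) _ _)

module Count {n t} {G : Graph n} {side : Fin n → Bool} (D : Diam3Bipartition G side) (T : Graph t) where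
  open Diam3Bipartition D
  open Side D T
  module Y = Side (swapSides D) T

  Y-Within : ∀ U V f → Y.Within U V f ≡ Within V U f
  Y-Within U V f = every-cong λ v → cong (λ W → W (f v)) (if-not (side v) {V} {U})

  OneSided TwoSided : Map n t → Bool
  OneSided f = ConstX f ∨ Y.ConstX f
  TwoSided f = not (OneSided f)

  #oneSided : (Fin t → Bool) → (Fin t → Bool) → ℕ
  #oneSided U V = #maps λ f → (isHom f ∧ OneSided f) ∧ Within U V f

  x y : ℕ
  x = size (λ v → not (side v))
  y = size side

  #maps-∑ : ∀ {P : Map n t → Bool} (Q : Fin t → Map n t → Bool) →
            (∀ f → 𝟙 (P f) ≡ ∑[ a ∈ allFin t ] 𝟙 (Q a f)) → #maps P ≡ ∑[ a ∈ allFin t ] #maps (Q a)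
  #maps-∑ Q eq = trans (∑-cong (allMaps t n) λ F → eq (lookup F)) (∑-comm (allMaps t n) (allFin t) _)

  #constX : ∀ U V → #maps (λ f → isHom f ∧ (ConstX f ∧ Within U V f)) ≡ constXCount T x y U V
  #constX U V = trans (#maps-∑ _ (hom-const U V)) (∑-cong (allFin t) λ a → #Within (⁅ a ⁆ ∩ U) (adj T a ∩ V))

  hom-constY : ∀ U V f → 𝟙 (isHom f ∧ (Y.ConstX f ∧ Within U V f))
                         ≡ ∑[ b ∈ allFin t ] 𝟙 (Within (adj T b ∩ U) (⁅ b ⁆ ∩ V) f)
  hom-constY U V f = trans (cong (λ W → 𝟙 (isHom f ∧ (Y.ConstX f ∧ W))) (sym (Y-Within V U f)))
                           (trans (Y.hom-const V U f) (∑-cong (allFin t) λ b → cong 𝟙 (Y-Within (⁅ b ⁆ ∩ V) (adj T b ∩ U) f)))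

  #constY : ∀ U V → #maps (λ f → isHom f ∧ (Y.ConstX f ∧ Within U V f)) ≡ constYCount T x y U V
  #constY U V = trans (#maps-∑ _ (hom-constY U V)) (∑-cong (allFin t) λ b → #Within (adj T b ∩ U) (⁅ b ⁆ ∩ V))

  hom-constXY : ∀ U V f → 𝟙 (isHom f ∧ (ConstX f ∧ (Y.ConstX f ∧ Within U V f)))
                        ≡ ∑[ b ∈ allFin t ] 𝟙 (isHom f ∧ (ConstX f ∧ Within U (⁅ b ⁆ ∩ V) f))
  hom-constXY U V f = begin
    𝟙 (isHom f ∧ (ConstX f ∧ (Y.ConstX f ∧ Within U V f)))
      ≡⟨ cong 𝟙 (sym (∧-assoc (isHom f) _ _)) ⟩
    𝟙 ((isHom f ∧ ConstX f) ∧ (Y.ConstX f ∧ Within U V f))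
      ≡⟨ 𝟙-∧ (isHom f ∧ ConstX f) _ ⟩
    𝟙 (isHom f ∧ ConstX f) * 𝟙 (Y.ConstX f ∧ Within U V f)
      ≡⟨ cong (λ W → 𝟙 (isHom f ∧ ConstX f) * 𝟙 (Y.ConstX f ∧ W)) (sym (Y-Within V U f)) ⟩
    𝟙 (isHom f ∧ ConstX f) * 𝟙 (Y.ConstX f ∧ Y.Within V U f)
      ≡⟨ cong (𝟙 (isHom f ∧ ConstX f) *_) (Y.const-split V U f) ⟩
    𝟙 (isHom f ∧ ConstX f) * (∑[ b ∈ allFin t ] 𝟙 (Y.Within (⁅ b ⁆ ∩ V) U f))
      ≡⟨ sym (∑-*ˡ (allFin t) (𝟙 (isHom f ∧ ConstX f)) _) ⟩
    (∑[ b ∈ allFin t ] 𝟙 (isHom f ∧ ConstX f) * 𝟙 (Y.Within (⁅ b ⁆ ∩ V) U f))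
      ≡⟨ ∑-cong (allFin t) (λ b → trans (sym (𝟙-∧ (isHom f ∧ ConstX f) _))
                                         (cong 𝟙 (trans (∧-assoc (isHom f) _ _)
                                                        (cong (λ W → isHom f ∧ (ConstX f ∧ W)) (Y-Within (⁅ b ⁆ ∩ V) U f))))) ⟩
    (∑[ b ∈ allFin t ] 𝟙 (isHom f ∧ (ConstX f ∧ Within U (⁅ b ⁆ ∩ V) f))) ∎
    where open ≡-Reasoning

  #constXY : ∀ U V → #maps (λ f → isHom f ∧ (ConstX f ∧ (Y.ConstX f ∧ Within U V f))) ≡ bothCount T x y U V
  #constXY U V = trans (#maps-∑ _ (hom-constXY U V)) (∑-cong (allFin t) λ b → #constX U (⁅ b ⁆ ∩ V))

  #oneSided-formula : ∀ U V → #oneSided U V + bothCount T x y U V ≡ constXCount T x y U V + constYCount T x y U V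
  #oneSided-formula U V = begin
    #oneSided U V + bothCount T x y U V
      ≡⟨ cong (#oneSided U V +_) (sym (#constXY U V)) ⟩
    #oneSided U V + #maps (λ f → isHom f ∧ (ConstX f ∧ (Y.ConstX f ∧ Within U V f)))
      ≡⟨ sym (∑-distrib-+ (allMaps t n) _ _) ⟩
    (∑[ F ∈ allMaps t n ] (𝟙 ((isHom (lookup F) ∧ OneSided (lookup F)) ∧ Within U V (lookup F))
                          + 𝟙 (isHom (lookup F) ∧ (ConstX (lookup F) ∧ (Y.ConstX (lookup F) ∧ Within U V (lookup F))))))
      ≡⟨ ∑-cong (allMaps t n) (λ F → 𝟙-inclusion-exclusion (isHom (lookup F)) _ _ _) ⟩
    (∑[ F ∈ allMaps t n ] (𝟙 (isHom (lookup F) ∧ (ConstX (lookup F) ∧ Within U V (lookup F)))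
                          + 𝟙 (isHom (lookup F) ∧ (Y.ConstX (lookup F) ∧ Within U V (lookup F)))))
      ≡⟨ ∑-distrib-+ (allMaps t n) _ _ ⟩
    #maps (λ f → isHom f ∧ (ConstX f ∧ Within U V f)) + #maps (λ f → isHom f ∧ (Y.ConstX f ∧ Within U V f))
      ≡⟨ cong₂ _+_ (#constX U V) (#constY U V) ⟩
    constXCount T x y U V + constYCount T x y U V ∎
    where open ≡-Reasoning

  module _ (acyclic : Acyclic T) where

    central-edge : ∀ {f} → IsHom G T f → ConstX f ≡ false → Y.ConstX f ≡ false →
                   ∃₂ λ c c′ → Adj T c c′ × AroundEdge c c′ f ≡ true
    central-edge {f} hom notConstX notConstY with centre acyclic hom notConstX | Y.centre acyclic hom notConstY
    ... | w , w∈Y , aroundX | w′ , w′∈X , aroundY =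
      f w , f w′ , Within-X aroundX (not-injective w′∈X) , Within⁺ (Within-X aroundX) inY
      where
      inY : ∀ {v} → side v ≡ true → adj T (f w′) (f v) ≡ true
      inY v∈Y = Y.Within-X aroundY (cong not v∈Y)

    central-edge-unique : ∀ {f c c′ d d′} → ConstX f ≡ false → Y.ConstX f ≡ false →
                          AroundEdge c c′ f ≡ true → AroundEdge d d′ f ≡ true → c ≡ d × c′ ≡ d′
    central-edge-unique {f} {c} {c′} {d} {d′} notConstX notConstY around-cc′ around-dd′ =
      centre-unique acyclic notConstX around-cc′ around-dd′ ,
      Y.centre-unique acyclic notConstY (trans (Y-Within (adj T c′) (adj T c) f) around-cc′)
                                        (trans (Y-Within (adj T d′) (adj T d) f) around-dd′)

    TwoSidedAround : Fin t → Fin t → Map n t → Bool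
    TwoSidedAround c c′ f = (isHom f ∧ TwoSided f) ∧ AroundEdge c c′ f

    twoSided-split : ∀ f → 𝟙 (isHom f ∧ TwoSided f)
                           ≡ ∑[ c ∈ allFin t ] ∑[ c′ ∈ allFin t ] 𝟙 (adj T c c′ ∧ TwoSidedAround c c′ f)
    twoSided-split f with isHom f ∧ TwoSided f in twoSided
    ... | false = sym (trans (∑-cong (allFin t) λ c → trans (∑-cong (allFin t) λ c′ → cong 𝟙 (∧-zeroʳ (adj T c c′)))
                                                             (∑-zero (allFin t)))
                             (∑-zero (allFin t)))
    ... | true = sym (trans (∑∑-supported _≟_ _≟_ (allFin t) (allFin t) (allFin-once t) (allFin-once t) _ only-centre)
                            (cong 𝟙 (∧-true⁺ (proj₁ (proj₂ (proj₂ edge))) (proj₂ (proj₂ (proj₂ edge))))))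
      where
      isHom∧twoSided : isHom f ≡ true × TwoSided f ≡ true
      isHom∧twoSided = ∧-true⁻ twoSided
      notConst : ConstX f ≡ false × Y.ConstX f ≡ false
      notConst = not-∨-true (proj₂ isHom∧twoSided)
      edge : ∃₂ λ c c′ → Adj T c c′ × AroundEdge c c′ f ≡ true
      edge = central-edge (does-true (isHom? G T f) (proj₁ isHom∧twoSided)) (proj₁ notConst) (proj₂ notConst)
      only-centre : ∀ c c′ → adj T c c′ ∧ AroundEdge c c′ f ≡ true → c ≡ proj₁ edge × c′ ≡ proj₁ (proj₂ edge)
      only-centre c c′ hit = central-edge-unique (proj₁ notConst) (proj₂ notConst)
                               (proj₂ (∧-true⁻ hit)) (proj₂ (proj₂ (proj₂ edge)))

    #homs-split : #maps isHom ≡ #oneSided (λ _ → true) (λ _ → true) + #maps (λ f → isHom f ∧ TwoSided f)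
    #homs-split = trans (∑-cong (allMaps t n) λ F → split (lookup F)) (∑-distrib-+ (allMaps t n) _ _)
      where
      split : ∀ f → 𝟙 (isHom f) ≡ 𝟙 ((isHom f ∧ OneSided f) ∧ Within (λ _ → true) (λ _ → true) f) + 𝟙 (isHom f ∧ TwoSided f)
      split f = trans (cong 𝟙 (sym (∧-identityʳ (isHom f))))
                      (trans (𝟙-split (isHom f) (OneSided f) true)
                             (cong₂ (λ w w′ → 𝟙 ((isHom f ∧ OneSided f) ∧ w) + 𝟙 w′)
                                    (sym (Within⁺ (λ _ → refl) (λ _ → refl))) (∧-identityʳ _)))

    #twoSided-edges : #maps (λ f → isHom f ∧ TwoSided f) ≡ edgeSum T (λ c c′ → #maps (TwoSidedAround c c′))
    #twoSided-edges = begin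
      #maps (λ f → isHom f ∧ TwoSided f)
        ≡⟨ ∑-cong (allMaps t n) (λ F → twoSided-split (lookup F)) ⟩
      (∑[ F ∈ allMaps t n ] ∑[ c ∈ allFin t ] ∑[ c′ ∈ allFin t ] 𝟙 (adj T c c′ ∧ TwoSidedAround c c′ (lookup F)))
        ≡⟨ ∑-comm (allMaps t n) (allFin t) _ ⟩
      (∑[ c ∈ allFin t ] ∑[ F ∈ allMaps t n ] ∑[ c′ ∈ allFin t ] 𝟙 (adj T c c′ ∧ TwoSidedAround c c′ (lookup F)))
        ≡⟨ ∑-cong (allFin t) (λ c → ∑-comm (allMaps t n) (allFin t) _) ⟩
      (∑[ c ∈ allFin t ] ∑[ c′ ∈ allFin t ] #maps (λ f → adj T c c′ ∧ TwoSidedAround c c′ f))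
        ≡⟨ ∑-cong (allFin t) (λ c → ∑-cong (allFin t) λ c′ → #maps-∧ˡ (adj T c c′) (TwoSidedAround c c′)) ⟩
      edgeSum T (λ c c′ → #maps (TwoSidedAround c c′)) ∎
      where open ≡-Reasoning

    #edge-split : ∀ {c c′} → Adj T c c′ →
                  #oneSided (adj T c) (adj T c′) + #maps (TwoSidedAround c c′) ≡ Z G side (size (adj T c ∖ ⁅ c′ ⁆)) (size (adj T c′))
    #edge-split {c} {c′} cc′ =
      trans (sym (∑-distrib-+ (allMaps t n) _ _))
            (trans (∑-cong (allMaps t n) λ F → sym (𝟙-split (isHom (lookup F)) (OneSided (lookup F)) _))
                   (EdgeStar.#hom-within acyclic cc′))

    decomposition : homCount G T + edgeSum T (λ c c′ → #oneSided (adj T c) (adj T c′))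
                    ≡ #oneSided (λ _ → true) (λ _ → true)
                      + edgeSum T (λ c c′ → Z G side (size (adj T c ∖ ⁅ c′ ⁆)) (size (adj T c′)))
    decomposition = begin
      homCount G T + edgeSum T #oneSided-at
        ≡⟨ cong (_+ edgeSum T #oneSided-at) (length-filter≡∑ (λ F → isHom? G T (lookup F)) (allMaps t n)) ⟩
      #maps isHom + edgeSum T #oneSided-at
        ≡⟨ cong (_+ edgeSum T #oneSided-at) (trans #homs-split (cong (#oneSided all all +_) #twoSided-edges)) ⟩
      (#oneSided all all + edgeSum T #twoSided-at) + edgeSum T #oneSided-at
        ≡⟨ +-assoc (#oneSided all all) _ _ ⟩
      #oneSided all all + (edgeSum T #twoSided-at + edgeSum T #oneSided-at)
        ≡⟨ cong (#oneSided all all +_) (trans (+-comm (edgeSum T #twoSided-at) _)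
                                              (sym (edgeSum-distrib-+ T #oneSided-at #twoSided-at))) ⟩
      #oneSided all all + edgeSum T (λ c c′ → #oneSided-at c c′ + #twoSided-at c c′)
        ≡⟨ cong (#oneSided all all +_) (edgeSum-cong T #edge-split) ⟩
      #oneSided all all + edgeSum T (λ c c′ → Z G side (size (adj T c ∖ ⁅ c′ ⁆)) (size (adj T c′))) ∎
      where
      open ≡-Reasoning
      all : Fin t → Bool
      all _ = true
      #oneSided-at #twoSided-at : Fin t → Fin t → ℕ
      #oneSided-at c c′ = #oneSided (adj T c) (adj T c′)
      #twoSided-at c c′ = #maps (TwoSidedAround c c′)

#oneSided-determined : ∀ {n m t} {G : Graph n} {H : Graph m} {sideG sideH}
  (DG : Diam3Bipartition G sideG) (DH : Diam3Bipartition H sideH) (T : Graph t) →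
  size (λ v → not (sideG v)) ≡ size (λ v → not (sideH v)) → size sideG ≡ size sideH →
  ∀ U V → Count.#oneSided DG T U V ≡ Count.#oneSided DH T U V
#oneSided-determined {sideG = sideG} {sideH} DG DH T |X|≡ |Y|≡ U V =
  +-cancelʳ-≡ (bothCount T xH yH U V) _ _ (begin
    Count.#oneSided DG T U V + bothCount T xH yH U V
      ≡⟨ cong₂ (λ x y → Count.#oneSided DG T U V + bothCount T x y U V) (sym |X|≡) (sym |Y|≡) ⟩
    Count.#oneSided DG T U V + bothCount T xG yG U V
      ≡⟨ Count.#oneSided-formula DG T U V ⟩
    constXCount T xG yG U V + constYCount T xG yG U V
      ≡⟨ cong₂ (λ x y → constXCount T x y U V + constYCount T x y U V) |X|≡ |Y|≡ ⟩
    constXCount T xH yH U V + constYCount T xH yH U V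
      ≡⟨ sym (Count.#oneSided-formula DH T U V) ⟩
    Count.#oneSided DH T U V + bothCount T xH yH U V ∎)
  where
  open ≡-Reasoning
  xG yG xH yH : ℕ
  xG = size (λ v → not (sideG v))
  yG = size sideG
  xH = size (λ v → not (sideH v))
  yH = size sideH

Z-≈ : ∀ {n m} {G : Graph n} {H : Graph m} (G≈H : G ≈ H) → let open NSEquiv G≈H in
      ∀ α β → Z G cG α β ≡ Z H cH α β
Z-≈ {n} {m} {G} {H} G≈H α β =
  trans (∑-cong (subsets n) transport)
        (∑-reindex (≡-dec _≟ᵇ_) (≡-dec _≟ᵇ_) (subsets n) (subsets m) (subsets-once n) (subsets-once m)
                   (_⊆? partX cG) (_⊆? partX cH) η (λ {S} → η-into S) (λ {S} {S′} → η-inj S S′) (λ {T} → η-surj T)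
                   (weight H cH))
  where
  open NSEquiv G≈H
  weight : ∀ {k} → Graph k → (Fin k → Bool) → Subset k → ℕ
  weight K side S = α ^ ∣ S ∣ * β ^ (∣ partY side ∣ ∸ ∣ N K S ∣)
  transport : ∀ S → 𝟙 (does (S ⊆? partX cG)) * weight G cG S ≡ 𝟙 (does (S ⊆? partX cG)) * weight H cH (η S)
  transport S with S ⊆? partX cG
  ... | yes S⊆X = cong (1 *_) (cong₂ (λ s r → α ^ s * β ^ r) (sym (η-size S S⊆X)) (cong₂ _∸_ |Y|≡ (sym (η-nbhd S S⊆X))))
  ... | no  _   = refl

theorem13 : ∀ {n m} (G : Graph n) (H : Graph m)
    → Connected G → Connected H → Bipartite G → Bipartite H
    → DiameterAtMost G 3 → DiameterAtMost H 3
    → G ≈ H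
    → ∀ {t} (T : Graph t) → IsTree T → homCount G T ≡ homCount H T
theorem13 G H connG connH _ _ diamG diamH G≈H {t} T (_ , acyclic) =
  +-cancelʳ-≡ (edgeSum T λ c c′ → #oneSidedᴴ (adj T c) (adj T c′)) _ _ (begin
    homCount G T + edgeSum T (λ c c′ → #oneSidedᴴ (adj T c) (adj T c′))
      ≡⟨ cong (homCount G T +_) (edgeSum-cong T λ _ → sym (same-oneSided _ _)) ⟩
    homCount G T + edgeSum T (λ c c′ → #oneSidedᴳ (adj T c) (adj T c′))
      ≡⟨ Count.decomposition DG T acyclic ⟩
    #oneSidedᴳ all all + edgeSum T (λ c c′ → Z G cG (size (adj T c ∖ ⁅ c′ ⁆)) (size (adj T c′)))
      ≡⟨ cong₂ _+_ (same-oneSided all all) (edgeSum-cong T λ _ → Z-≈ G≈H _ _) ⟩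
    #oneSidedᴴ all all + edgeSum T (λ c c′ → Z H cH (size (adj T c ∖ ⁅ c′ ⁆)) (size (adj T c′)))
      ≡⟨ sym (Count.decomposition DH T acyclic) ⟩
    homCount H T + edgeSum T (λ c c′ → #oneSidedᴴ (adj T c) (adj T c′)) ∎)
  where
  open ≡-Reasoning
  open NSEquiv G≈H
  -- The bipartitions are the ones supplied by G ≈ H.
  DG : Diam3Bipartition G cG
  DG = diam3Bipartition twoG connG bipG diamG
  DH : Diam3Bipartition H cH
  DH = diam3Bipartition twoH connH bipH diamH
  #oneSidedᴳ #oneSidedᴴ : (Fin t → Bool) → (Fin t → Bool) → ℕ
  #oneSidedᴳ = Count.#oneSided DG T
  #oneSidedᴴ = Count.#oneSided DH T
  all : Fin t → Bool
  all _ = true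
  same-oneSided : ∀ U V → #oneSidedᴳ U V ≡ #oneSidedᴴ U V
  same-oneSided = #oneSided-determined DG DH T
    (trans (sym (∣tabulate∣≡size (λ v → not (cG v)))) (trans |X|≡ (∣tabulate∣≡size (λ v → not (cH v)))))
    (trans (sym (∣tabulate∣≡size cG)) (trans |Y|≡ (∣tabulate∣≡size cH)))
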